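{- Let $k \ge m \ge 2$ be integers and let $H$ be a finite graph. Then $$\tilde{r}(P_k,H) \ge \tilde{r}(P_m,H) + \left\lfloor\frac{k-1}{m-1} \right\rfloor - 1.$$
   Context: $P_\ell$ denotes the path on $\ell$ vertices. For finite graphs $G,H$, the online Ramsey number $\tilde{r}(G,H)$ is defined via the following game between Builder and Painter on the infinite vertex set $\mathbb{N}$: in each round Builder selects a previously unselected edge between two vertices and Painter colours it red or blue; the game ends as soon as there is a red copy of $G$ or a blue copy of $H$. Builder aims to minimise and Painter to maximise the number of rounds; $\tilde{r}(G,H)$ is the number of rounds under optimal play by both. -}

module Defs where

open import Data.Nat using (ℕ; zero; suc; _≡ᵇ_; _<_)
open import Data.Fin using (Fin; toℕ)
open import Data.Bool using (Bool; true; false; _∨_)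
open import Data.List using (List; _∷_)
open import Data.List.Membership.Propositional using (_∈_)
open import Data.Product using (Σ; _×_; _,_)
open import Data.Sum using (_⊎_)
open import Relation.Binary.PropositionalEquality using (_≡_; _≢_)
open import Relation.Nullary using (¬_)
open import Function.Definitions using (Injective)

-- A finite graph: vertex set Fin V, adjacency given by a Boolean function.
-- (Edges are read as unordered: a copy must realise E i j ≡ true
-- as a coloured edge in either orientation.)
record Graph : Set where
  field
    V : ℕ
    E : Fin V → Fin V → Bool
open Graph public

P : ℕ → Graph
P ℓ = record { V = ℓ ; E = λ i j → (suc (toℕ i) ≡ᵇ toℕ j) ∨ (suc (toℕ j) ≡ᵇ toℕ i) }

data Colour : Set where
  red blue : Colour

-- The board: the list of edges selected so far (on vertex set ℕ),
-- each with the colour Painter gave it.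
Board : Set
Board = List (ℕ × ℕ × Colour)

Coloured : Colour → Board → ℕ → ℕ → Set
Coloured c B u v = ((u , v , c) ∈ B) ⊎ ((v , u , c) ∈ B)

Fresh : Board → ℕ → ℕ → Set
Fresh B u v = (c : Colour) → ¬ Coloured c B u v

CopyIn : Colour → Graph → Board → Set
CopyIn c G B = Σ (Fin (V G) → ℕ) λ f → Injective _≡_ _≡_ f ×
  ((i j : Fin (V G)) → E G i j ≡ true → Coloured c B (f i) (f j))

Over : Graph → Graph → Board → Set
Over G H B = CopyIn red G B ⊎ CopyIn blue H B

BuilderWins : Graph → Graph → ℕ → Board → Set
BuilderWins G H zero B = Over G H B
BuilderWins G H (suc n) B = Over G H B ⊎
  Σ ℕ λ u → Σ ℕ λ v → u ≢ v × Fresh B u v ×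
    ((c : Colour) → BuilderWins G H n ((u , v , c) ∷ B))

IsOnlineRamsey : Graph → Graph → ℕ → Set
IsOnlineRamsey G H r = BuilderWins G H r Data.List.[] ×
  ((s : ℕ) → s < r → ¬ BuilderWins G H s Data.List.[])

-- Let d = m − 1 and q = ⌊(k − 1)/d⌋. A red P_k contains a red path with q·d edges, which
-- splits into q windows of d consecutive edges; any q − 1 edges miss one whole window, so
-- removing fewer than q red edges from a board with a red P_k leaves a red P_m (= P_(d+1)).
-- Painter therefore answers the first q − 1 rounds red: that cannot end the game, and the
-- rest of Builder's (P_k, H) strategy, played with those red edges ignored, is a
-- (P_m, H) strategy from the empty board.
module Submission where

open import Defs
open import Data.Nat using (ℕ; _≤_; _+_; _∸_; _/_; NonZero)
open import Data.Fin using (Fin)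
open import Data.Bool using (true)
open import Data.Product using (Σ)
open import Relation.Binary.PropositionalEquality using (_≡_)

open import Data.Nat using (zero; suc; _<_; _*_; _<?_; z≤n; s≤s; s≤s⁻¹; z<s)
open import Data.Nat.Properties
open import Data.Nat.DivMod using (m/n*n≤m; m≥n⇒m/n>0)
open import Data.Fin as Fin using (toℕ; fromℕ<; combine)
open import Data.Fin.Properties
  using (toℕ-fromℕ<; toℕ-injective; toℕ<n; toℕ≤pred[n]; toℕ-combine; combine-injectiveˡ;
         pigeonhole; any?; all?; ¬∀⟶∃¬)
open import Data.Bool.Properties using (T-≡; T-∨)
open import Data.List using (List; []; _∷_; _++_; length; lookup)
open import Data.List.Membership.Propositional using (_∈_)
open import Data.List.Membership.Propositional.Properties using (∈-++⁻; ∈-++⁺ˡ)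
import Data.List.Membership.DecPropositional as DecMembership
open import Data.List.Relation.Unary.All as All using (All; []; _∷_)
open import Data.List.Relation.Unary.Any using (index)
open import Data.List.Relation.Unary.Any.Properties using (lookup-index)
open import Data.Product as Product using (_×_; _,_; proj₁; proj₂)
open import Data.Product.Properties using (≡-dec)
open import Data.Sum as Sum using (_⊎_; inj₁; inj₂; [_,_]; swap)
open import Data.Empty using (⊥-elim)
open import Function using (_∘_; id; Equivalence)
open import Function.Definitions using (Injective)
open import Relation.Nullary using (¬_; Dec; yes; no; contradiction)
open import Relation.Nullary.Decidable using (_⊎-dec_)
open import Relation.Binary.Definitions using (DecidableEquality)
open import Relation.Binary.PropositionalEquality
  using (_≢_; refl; sym; trans; cong; subst; module ≡-Reasoning)

_≟ᶜ_ : DecidableEquality Colour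
red  ≟ᶜ red  = yes refl
red  ≟ᶜ blue = no λ ()
blue ≟ᶜ red  = no λ ()
blue ≟ᶜ blue = yes refl

open DecMembership (≡-dec _≟_ (≡-dec _≟_ _≟ᶜ_)) using (_∈?_)

coloured? : ∀ c B u v → Dec (Coloured c B u v)
coloured? c B u v = ((u , v , c) ∈? B) ⊎-dec ((v , u , c) ∈? B)

coloured-++⁻ : ∀ {c} S {F u v} → Coloured c (S ++ F) u v → Coloured c S u v ⊎ Coloured c F u v
coloured-++⁻ S (inj₁ uv) = Sum.map inj₁ inj₁ (∈-++⁻ S uv)
coloured-++⁻ S (inj₂ vu) = Sum.map inj₂ inj₂ (∈-++⁻ S vu)

Monochromatic : Colour → Board → Set
Monochromatic c = All λ (_ , _ , c′) → c′ ≡ c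

coloured-monochromatic : ∀ {c c′ F u v} → Monochromatic c′ F → Coloured c F u v → c ≡ c′
coloured-monochromatic mono = [ All.lookup mono , All.lookup mono ]

copy-++-other-colour : ∀ {c c′ G} S {F} → c ≢ c′ → Monochromatic c′ F →
  CopyIn c G (S ++ F) → CopyIn c G S
copy-++-other-colour S c≢c′ mono (f , f-injective , f-edges) = f , f-injective , λ i j e →
  [ id , (λ inF → contradiction (coloured-monochromatic mono inF) c≢c′) ]
    (coloured-++⁻ S (f-edges i j e))

no-copy-on-empty : ∀ {c G} i j → E G i j ≡ true → ¬ CopyIn c G []
no-copy-on-empty i j e (_ , _ , f-edges) with f-edges i j e
... | inj₁ ()
... | inj₂ ()

slot : ∀ {c F u v} → Coloured c F u v → Fin (length F)
slot = [ index , index ]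

∈-same-index : ∀ {A : Set} {xs : List A} {a b} (p : a ∈ xs) (q : b ∈ xs) → index p ≡ index q → a ≡ b
∈-same-index {xs = xs} p q eq =
  trans (lookup-index p) (trans (cong (lookup xs) eq) (sym (lookup-index q)))

endpoints-≡ : ∀ {u v u′ v′ : ℕ} {c c′ : Colour} → (u , v , c) ≡ (u′ , v′ , c′) → u ≡ u′ × v ≡ v′
endpoints-≡ eq = cong proj₁ eq , cong (proj₁ ∘ proj₂) eq

same-slot : ∀ {c c′ F u v u′ v′} (x : Coloured c F u v) (y : Coloured c′ F u′ v′) →
  slot x ≡ slot y → (u ≡ u′ × v ≡ v′) ⊎ (u ≡ v′ × v ≡ u′)
same-slot (inj₁ x) (inj₁ y) eq = inj₁ (endpoints-≡ (∈-same-index x y eq))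
same-slot (inj₂ x) (inj₂ y) eq = inj₁ (Product.swap (endpoints-≡ (∈-same-index x y eq)))
same-slot (inj₁ x) (inj₂ y) eq = inj₂ (endpoints-≡ (∈-same-index x y eq))
same-slot (inj₂ x) (inj₁ y) eq = inj₂ (Product.swap (endpoints-≡ (∈-same-index x y eq)))

P-edge⁺ : ∀ {ℓ} (i j : Fin ℓ) → toℕ j ≡ suc (toℕ i) → E (P ℓ) i j ≡ true
P-edge⁺ i j j≡1+i = Equivalence.to T-≡ (Equivalence.from T-∨ (inj₁ (≡⇒≡ᵇ _ _ (sym j≡1+i))))

P-edge⁻ : ∀ {ℓ} (i j : Fin ℓ) → E (P ℓ) i j ≡ true → toℕ j ≡ suc (toℕ i) ⊎ toℕ i ≡ suc (toℕ j)
P-edge⁻ i j e =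
  Sum.map (sym ∘ ≡ᵇ⇒≡ _ _) (sym ∘ ≡ᵇ⇒≡ _ _) (Equivalence.to T-∨ (Equivalence.from T-≡ e))

record IsPath (c : Colour) (B : Board) (n : ℕ) (g : ℕ → ℕ) : Set where
  field
    injective : ∀ {i j} → i ≤ n → j ≤ n → g i ≡ g j → i ≡ j
    edge      : ∀ {i} → i < n → Coloured c B (g i) (g (suc i))

path⇒copy : ∀ {c B n g} → IsPath c B n g → CopyIn c (P (suc n)) B
path⇒copy {c} {B} {n} {g} path =
  g ∘ toℕ , injective′ , λ i j → [ step i j , swap ∘ step j i ] ∘ P-edge⁻ i j
  where
  open IsPath path
  injective′ : Injective _≡_ _≡_ (g ∘ toℕ)
  injective′ {i} {j} = toℕ-injective ∘ injective (toℕ≤pred[n] i) (toℕ≤pred[n] j)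
  step : ∀ i j → toℕ j ≡ suc (toℕ i) → Coloured c B (g (toℕ i)) (g (toℕ j))
  step i j j≡1+i = subst (Coloured c B (g (toℕ i)) ∘ g) (sym j≡1+i)
    (edge (s≤s⁻¹ (subst (_< suc n) j≡1+i (toℕ<n j))))

extend : ∀ {m} → (Fin m → ℕ) → ℕ → ℕ
extend {m} f i with i <? m
... | yes i<m = f (fromℕ< i<m)
... | no _    = 0

extend-fromℕ< : ∀ {m} (f : Fin m → ℕ) {i} (i<m : i < m) → extend f i ≡ f (fromℕ< i<m)
extend-fromℕ< {m} f {i} i<m with i <? m
... | yes _   = refl
... | no i≮m = contradiction i<m i≮m

copy⇒path : ∀ {c B n} → CopyIn c (P (suc n)) B → Σ (ℕ → ℕ) (IsPath c B n)
copy⇒path {c} {B} {n} (f , f-injective , f-edges) =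
  extend f , record { injective = injective ; edge = edge }
  where
  open ≡-Reasoning
  injective : ∀ {i j} → i ≤ n → j ≤ n → extend f i ≡ extend f j → i ≡ j
  injective {i} {j} i≤n j≤n eq = begin
    i                      ≡⟨ toℕ-fromℕ< (s≤s i≤n) ⟨
    toℕ (fromℕ< (s≤s i≤n)) ≡⟨ cong toℕ (f-injective (begin
      f (fromℕ< (s≤s i≤n))   ≡⟨ extend-fromℕ< f (s≤s i≤n) ⟨
      extend f i             ≡⟨ eq ⟩
      extend f j             ≡⟨ extend-fromℕ< f (s≤s j≤n) ⟩
      f (fromℕ< (s≤s j≤n))   ∎)) ⟩
    toℕ (fromℕ< (s≤s j≤n)) ≡⟨ toℕ-fromℕ< (s≤s j≤n) ⟩
    j                      ∎
  edge : ∀ {i} → i < n → Coloured c B (extend f i) (extend f (suc i))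
  edge {i} i<n rewrite extend-fromℕ< f (s≤s (<⇒≤ i<n)) | extend-fromℕ< f (s≤s i<n) =
    f-edges _ _ (P-edge⁺ _ _
      (trans (toℕ-fromℕ< (s≤s i<n)) (cong suc (sym (toℕ-fromℕ< (s≤s (<⇒≤ i<n)))))))

path-segment : ∀ {c B n g} a {l} → a + l ≤ n → IsPath c B n g → IsPath c B l (λ i → g (a + i))
path-segment {c} {B} {n} {g} a {l} a+l≤n path = record
  { injective = λ i≤l j≤l → +-cancelˡ-≡ a _ _ ∘ injective (shifted i≤l) (shifted j≤l)
  ; edge      = λ {i} i<l → subst (Coloured c B (g (a + i)) ∘ g) (sym (+-suc a i))
                  (edge (subst (_≤ n) (+-suc a i) (shifted i<l)))
  }
  where
  open IsPath path
  shifted : ∀ {i} → i ≤ l → a + i ≤ n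
  shifted i≤l = ≤-trans (+-monoʳ-≤ a i≤l) a+l≤n

edge-position-injective : ∀ {c B n g i j} → IsPath c B n g → i < n → j < n →
  (g i ≡ g j × g (suc i) ≡ g (suc j)) ⊎ (g i ≡ g (suc j) × g (suc i) ≡ g j) → i ≡ j
edge-position-injective path i<n j<n (inj₁ (same , _)) =
  IsPath.injective path (<⇒≤ i<n) (<⇒≤ j<n) same
edge-position-injective {i = i} {j} path i<n j<n (inj₂ (i~1+j , 1+i~j)) =
  contradiction (subst (j <_) (sym i≡1+j) (n<1+n j)) (<-asym (subst (i <_) 1+i≡j (n<1+n i)))
  where
  open IsPath path
  i≡1+j : i ≡ suc j
  i≡1+j = injective (<⇒≤ i<n) j<n i~1+j
  1+i≡j : suc i ≡ j
  1+i≡j = injective i<n (<⇒≤ j<n) 1+i~j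

-- Window w : Fin q consists of the path edges at positions d·w + t for t : Fin d,
-- which is how combine numbers them (toℕ-combine).
module Windows {c S F g} (q d : ℕ) (path : IsPath c (S ++ F) (q * d) g) where

  position : Fin q → Fin d → ℕ
  position w t = toℕ (combine w t)

  EdgeIn : Board → ℕ → Set
  EdgeIn B p = Coloured c B (g p) (g (suc p))

  Clean : Fin q → Set
  Clean w = ∀ t → EdgeIn S (position w t)

  clean? : ∀ w → Dec (Clean w)
  clean? w = all? λ t → coloured? c S _ _

  position-fromℕ< : ∀ w {i} (i<d : i < d) → position w (fromℕ< i<d) ≡ d * toℕ w + i
  position-fromℕ< w i<d = trans (toℕ-combine w (fromℕ< i<d)) (cong (d * toℕ w +_) (toℕ-fromℕ< i<d))

  position<q*d : ∀ w t → position w t < q * d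
  position<q*d w t = toℕ<n (combine w t)

  window : ∀ w → IsPath c (S ++ F) d (λ i → g (d * toℕ w + i))
  window w = path-segment (d * toℕ w) fits path
    where
    open ≤-Reasoning
    fits : d * toℕ w + d ≤ q * d
    fits = begin
      d * toℕ w + d   ≡⟨ +-comm (d * toℕ w) d ⟩
      d + d * toℕ w   ≡⟨ *-suc d (toℕ w) ⟨
      d * suc (toℕ w) ≤⟨ *-monoʳ-≤ d (toℕ<n w) ⟩
      d * q           ≡⟨ *-comm d q ⟩
      q * d           ∎

  clean-window-path : ∀ {w} → Clean w → IsPath c S d (λ i → g (d * toℕ w + i))
  clean-window-path {w} clean = record
    { injective = IsPath.injective (window w)
    ; edge      = λ {i} i<d →
        subst (Coloured c S (g (d * toℕ w + i)) ∘ g) (sym (+-suc (d * toℕ w) i))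
        (subst (EdgeIn S) (position-fromℕ< w i<d) (clean (fromℕ< i<d)))
    }

  dirty-edge : ∀ w → ¬ Clean w → Σ (Fin d) λ t → EdgeIn F (position w t)
  dirty-edge w dirty with ¬∀⟶∃¬ d _ (λ t → coloured? c S _ _) dirty
  ... | t , ∉S = t , [ (λ ∈S → contradiction ∈S ∉S) , id ]
                       (coloured-++⁻ S (IsPath.edge path (position<q*d w t)))

  window-edges-injective : (e : ∀ w → Σ (Fin d) λ t → EdgeIn F (position w t)) →
    ∀ w w′ → slot (proj₂ (e w)) ≡ slot (proj₂ (e w′)) → w ≡ w′
  window-edges-injective e w w′ same = combine-injectiveˡ _ _ _ _ (toℕ-injective
    (edge-position-injective path (position<q*d w _) (position<q*d w′ _)
      (same-slot (proj₂ (e w)) (proj₂ (e w′)) same)))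

  some-window-clean : length F < q → ¬ (∀ w → ¬ Clean w)
  some-window-clean |F|<q all-dirty =
    let w , w′ , w<w′ , same = pigeonhole |F|<q (slot ∘ proj₂ ∘ dirty)
    in <-irrefl (cong toℕ (window-edges-injective dirty w w′ same)) w<w′
    where
    dirty : ∀ w → Σ (Fin d) λ t → EdgeIn F (position w t)
    dirty w = dirty-edge w (all-dirty w)

  clean-window : length F < q → Σ ℕ λ a → IsPath c S d (λ i → g (a + i))
  clean-window |F|<q with any? clean?
  ... | yes (w , clean) = d * toℕ w , clean-window-path clean
  ... | no no-clean     = ⊥-elim (some-window-clean |F|<q λ w clean → no-clean (w , clean))

open Windows using (clean-window)

path-copy-++ : ∀ {c q d k} S {F} → q * d ≤ k → length F < q →
  CopyIn c (P (suc k)) (S ++ F) → CopyIn c (P (suc d)) S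
path-copy-++ {q = q} {d} S q*d≤k |F|<q copy =
  let g , path = copy⇒path copy
      _ , window = clean-window {S = S} q d (path-segment 0 q*d≤k path) |F|<q
  in path⇒copy window

over-++-red : ∀ {H q d k} S {F} → q * d ≤ k → length F < q → Monochromatic red F →
  Over (P (suc k)) H (S ++ F) → Over (P (suc d)) H S
over-++-red S q*d≤k |F|<q red-F =
  Sum.map (path-copy-++ S q*d≤k |F|<q) (copy-++-other-colour S (λ ()) red-F)

wins-ignoring : ∀ {G H G′ H′} F → (∀ S → Over G H (S ++ F) → Over G′ H′ S) →
  ∀ n S → BuilderWins G H n (S ++ F) → BuilderWins G′ H′ n S
wins-ignoring F transfer zero    S over        = transfer S over
wins-ignoring F transfer (suc n) S (inj₁ over) = inj₁ (transfer S over)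
wins-ignoring F transfer (suc n) S (inj₂ (u , v , u≢v , fresh , next)) =
  inj₂ (u , v , u≢v , (λ c → fresh c ∘ Sum.map ∈-++⁺ˡ ∈-++⁺ˡ) ,
        λ c → wins-ignoring F transfer n ((u , v , c) ∷ S) (next c))

module _ {G H : Graph} (q : ℕ)
         (short-red-live : ∀ R → Monochromatic red R → length R < q → ¬ Over G H R) where

  private
    live : ∀ {R t} → Monochromatic red R → length R + suc t < q → ¬ Over G H R
    live {R} {t} red-R bound =
      short-red-live R red-R (≤-<-trans (m≤m+n (length R) (suc t)) bound)

  red-rounds : ∀ t n R → Monochromatic red R → length R + t < q → BuilderWins G H n R →
    t ≤ n × Σ Board λ R′ → Monochromatic red R′ × length R′ < q × BuilderWins G H (n ∸ t) R′
  red-rounds zero n R red-R bound wins =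
    z≤n , R , red-R , subst (_< q) (+-identityʳ _) bound , wins
  red-rounds (suc t) zero R red-R bound over = ⊥-elim (live red-R bound over)
  red-rounds (suc t) (suc n) R red-R bound (inj₁ over) = ⊥-elim (live red-R bound over)
  red-rounds (suc t) (suc n) R red-R bound (inj₂ (u , v , _ , _ , next)) =
    Product.map₁ s≤s (red-rounds t n ((u , v , red) ∷ R) (refl ∷ red-R)
      (subst (_< q) (+-suc (length R) t) bound) (next red))

no-over-on-empty : ∀ {d H} → Σ (Fin (V H)) (λ i → Σ (Fin (V H)) (λ j → E H i j ≡ true)) →
  ¬ Over (P (suc (suc d))) H []
no-over-on-empty (i , j , e) =
  [ no-copy-on-empty Fin.zero (Fin.suc Fin.zero) refl , no-copy-on-empty i j e ]

lemma2p2 : (k m : ℕ) → 2 ≤ m → m ≤ k → (H : Graph) →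
    Σ (Fin (V H)) (λ i → Σ (Fin (V H)) (λ j → E H i j ≡ true)) →
    (a b : ℕ) → IsOnlineRamsey (P k) H a → IsOnlineRamsey (P m) H b →
    .{{_ : NonZero (m ∸ 1)}} →
    b + ((k ∸ 1) / (m ∸ 1)) ∸ 1 ≤ a
lemma2p2 (suc k) (suc (suc d₀)) _ (s≤s d≤k) H H-edge a b (a-wins , _) (_ , b-minimal) =
  let q-1≤a , R , red-R , |R|<q , wins =
        red-rounds q no-short-red-end (q ∸ 1) a [] [] (∸-monoʳ-< z<s 0<q) a-wins
      b≤a∸[q-1] = ≮⇒≥ λ fewer → b-minimal _ fewer
        (wins-ignoring R (λ S → over-++-red S q*d≤k |R|<q red-R) _ [] wins)
  in subst (_≤ a) (sym (+-∸-assoc b 0<q)) (m≤o∸n⇒m+n≤o b q-1≤a b≤a∸[q-1])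
  where
  d = suc d₀
  q = k / d
  q*d≤k : q * d ≤ k
  q*d≤k = m/n*n≤m k d
  0<q : 0 < q
  0<q = m≥n⇒m/n>0 d≤k
  no-short-red-end : ∀ R → Monochromatic red R → length R < q → ¬ Over (P (suc k)) H R
  no-short-red-end R red-R |R|<q = no-over-on-empty H-edge ∘ over-++-red [] q*d≤k |R|<q red-R
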